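{- The equational theory $E$ consisting of the single one-sided distributivity axiom $X \times (Y + Z) = X \times Y + X \times Z$ is subterm-collapse free: for every term $t$ over the signature $\{+,\times\}$ and variables, and every proper subterm $s$ of $t$, we have $t \neq_E s$.
   Context: $+$ and $\times$ are binary function symbols; $=_E$ is the equational theory generated by the axiom (its congruence closure under substitution). A term $s$ is a proper subterm of $t$ if $s = t|_p$ for some position $p \neq \epsilon$ of $t$. -}

module Defs where

open import Data.Nat using (ℕ)
open import Relation.Nullary using (¬_)

data Term : Set where
  var  : ℕ → Term
  _⊕_  : Term → Term → Term
  _⊗_  : Term → Term → Term

infixl 6 _⊕_
infixl 7 _⊗_

Subst : Set
Subst = ℕ → Term

_[_] : Term → Subst → Term
var x   [ σ ] = σ x
(s ⊕ t) [ σ ] = (s [ σ ]) ⊕ (t [ σ ])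
(s ⊗ t) [ σ ] = (s [ σ ]) ⊗ (t [ σ ])

axLhs axRhs : Term
axLhs = var 0 ⊗ (var 1 ⊕ var 2)
axRhs = (var 0 ⊗ var 1) ⊕ (var 0 ⊗ var 2)

-- =_E : the equational theory generated by the axiom, i.e. the least
-- congruence relation containing all substitution instances of the axiom
-- (closed under substitution by construction).
data _=E_ : Term → Term → Set where
  E-ax    : ∀ σ → (axLhs [ σ ]) =E (axRhs [ σ ])
  E-refl  : ∀ {t} → t =E t
  E-sym   : ∀ {s t} → s =E t → t =E s
  E-trans : ∀ {s t u} → s =E t → t =E u → s =E u
  E-⊕     : ∀ {s s' t t'} → s =E s' → t =E t' → (s ⊕ t) =E (s' ⊕ t')
  E-⊗     : ∀ {s s' t t'} → s =E s' → t =E t' → (s ⊗ t) =E (s' ⊗ t')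

infix 4 _=E_

data Dir : Set where
  left right : Dir


open import Data.List using (List; []; _∷_)
open import Data.Maybe using (Maybe; just; nothing)

Position : Set
Position = List Dir

_at_ : Term → Position → Maybe Term
t       at []            = just t
var _   at (_ ∷ _)       = nothing
(s ⊕ t) at (left  ∷ p)   = s at p
(s ⊕ t) at (right ∷ p)   = t at p
(s ⊗ t) at (left  ∷ p)   = s at p
(s ⊗ t) at (right ∷ p)   = t at p

-- Evaluate terms in ℕ with every variable at least 2. Left distributivity holds in ℕ, so
-- E-equal terms have equal values; and since every value is at least 2, both a + b and a × b
-- exceed a and b, so a proper subterm always has strictly smaller value than the whole term.
module Submission where

open import Defs
open import Data.List using ([]; _∷_)
open import Data.Maybe using (just)
open import Data.Nat using (ℕ; _+_; _*_; _≤_; _<_; s≤s; z≤n; >-nonZero)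
open import Data.Nat.Properties
open import Relation.Binary.PropositionalEquality using (_≡_; _≢_; refl; sym; trans; cong₂)
open import Relation.Nullary using (¬_)

module _ (ρ : ℕ → ℕ) where

  ⟦_⟧ : Term → ℕ
  ⟦ var x ⟧ = ρ x
  ⟦ a ⊕ b ⟧ = ⟦ a ⟧ + ⟦ b ⟧
  ⟦ a ⊗ b ⟧ = ⟦ a ⟧ * ⟦ b ⟧

  ⟦⟧-sound : ∀ {s t} → s =E t → ⟦ s ⟧ ≡ ⟦ t ⟧
  ⟦⟧-sound (E-ax σ)      = *-distribˡ-+ ⟦ σ 0 ⟧ ⟦ σ 1 ⟧ ⟦ σ 2 ⟧
  ⟦⟧-sound E-refl        = refl
  ⟦⟧-sound (E-sym e)     = sym (⟦⟧-sound e)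
  ⟦⟧-sound (E-trans e f) = trans (⟦⟧-sound e) (⟦⟧-sound f)
  ⟦⟧-sound (E-⊕ e f)     = cong₂ _+_ (⟦⟧-sound e) (⟦⟧-sound f)
  ⟦⟧-sound (E-⊗ e f)     = cong₂ _*_ (⟦⟧-sound e) (⟦⟧-sound f)

module _ (ρ : ℕ → ℕ) (ρ≥2 : ∀ x → 2 ≤ ρ x) where

  private
    ⟦_⟧ρ : Term → ℕ
    ⟦ t ⟧ρ = ⟦ ρ ⟧ t

  ⟦⟧≥2 : ∀ t → 2 ≤ ⟦ t ⟧ρ
  ⟦⟧>0 : ∀ t → 0 < ⟦ t ⟧ρ
  ⟦⟧≥2 (var x) = ρ≥2 x
  ⟦⟧≥2 (a ⊕ b) = ≤-trans (⟦⟧≥2 a) (m≤m+n ⟦ a ⟧ρ ⟦ b ⟧ρ)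
  ⟦⟧≥2 (a ⊗ b) = ≤-trans (⟦⟧≥2 a) (m≤m*n ⟦ a ⟧ρ ⟦ b ⟧ρ {{>-nonZero (⟦⟧>0 b)}})
  ⟦⟧>0 t = ≤-trans (s≤s z≤n) (⟦⟧≥2 t)

  ⟦⟧-<-⊕ˡ : ∀ a b → ⟦ a ⟧ρ < ⟦ a ⊕ b ⟧ρ
  ⟦⟧-<-⊕ˡ a b = m<m+n ⟦ a ⟧ρ (⟦⟧>0 b)

  ⟦⟧-<-⊕ʳ : ∀ a b → ⟦ b ⟧ρ < ⟦ a ⊕ b ⟧ρ
  ⟦⟧-<-⊕ʳ a b = m<n+m ⟦ b ⟧ρ (⟦⟧>0 a)

  ⟦⟧-<-⊗ˡ : ∀ a b → ⟦ a ⟧ρ < ⟦ a ⊗ b ⟧ρ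
  ⟦⟧-<-⊗ˡ a b = m<m*n ⟦ a ⟧ρ ⟦ b ⟧ρ {{>-nonZero (⟦⟧>0 a)}} (⟦⟧≥2 b)

  ⟦⟧-<-⊗ʳ : ∀ a b → ⟦ b ⟧ρ < ⟦ a ⊗ b ⟧ρ
  ⟦⟧-<-⊗ʳ a b = <-≤-trans (m<m*n ⟦ b ⟧ρ ⟦ a ⟧ρ {{>-nonZero (⟦⟧>0 b)}} (⟦⟧≥2 a))
                           (≤-reflexive (*-comm ⟦ b ⟧ρ ⟦ a ⟧ρ))

  at-⟦⟧-≤ : ∀ t p {s} → t at p ≡ just s → ⟦ s ⟧ρ ≤ ⟦ t ⟧ρ
  at-∷-⟦⟧-< : ∀ t d p {s} → t at (d ∷ p) ≡ just s → ⟦ s ⟧ρ < ⟦ t ⟧ρ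
  at-⟦⟧-≤ t []      refl = ≤-refl
  at-⟦⟧-≤ t (d ∷ p) t|p  = <⇒≤ (at-∷-⟦⟧-< t d p t|p)
  at-∷-⟦⟧-< (a ⊕ b) left  p t|p = ≤-<-trans (at-⟦⟧-≤ a p t|p) (⟦⟧-<-⊕ˡ a b)
  at-∷-⟦⟧-< (a ⊕ b) right p t|p = ≤-<-trans (at-⟦⟧-≤ b p t|p) (⟦⟧-<-⊕ʳ a b)
  at-∷-⟦⟧-< (a ⊗ b) left  p t|p = ≤-<-trans (at-⟦⟧-≤ a p t|p) (⟦⟧-<-⊗ˡ a b)
  at-∷-⟦⟧-< (a ⊗ b) right p t|p = ≤-<-trans (at-⟦⟧-≤ b p t|p) (⟦⟧-<-⊗ʳ a b)

theorem4p4 : (t s : Term) (p : Position) → p ≢ [] → t at p ≡ just s →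
    ¬ (t =E s)
theorem4p4 t s []      p≢[] _   _   = p≢[] refl
theorem4p4 t s (d ∷ p) _    t|p t=s =
  <-irrefl (sym (⟦⟧-sound two t=s)) (at-∷-⟦⟧-< two (λ _ → ≤-refl) t d p t|p)
  where
  two : ℕ → ℕ
  two _ = 2
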